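{- Let $n\ge1$. Each of the sets $A_n$ and $R_n$, listed in Co-Reflected Gray Code order $\prec_c$, is a $2$-adjacent Gray code: consecutive sequences differ in at most $2$ positions, and these positions are adjacent.
   Context: Statistics of $s_1\ldots s_k$: $\mathrm{asc}=\#\{i<k: s_i<s_{i+1}\}$, $\max=\max_i s_i$. $A_n$ (resp. $R_n$) is the set of sequences $s_1\ldots s_n$ of non-negative integers with $s_1=0$ and $0\le s_{k+1}\le \mathrm{asc}(s_1\ldots s_k)+1$ (resp. $\le\max(s_1\ldots s_k)+1$) for $1\le k<n$. Co-Reflected Gray Code order: $s\prec_c t$ if, with $k$ the rightmost position where $s$ and $t$ differ, either $\sum_{i=k+1}^n s_i+(n-k)$ is even and $s_k>t_k$, or it is odd and $s_k<t_k$. A $d$-adjacent Gray code is a list in which consecutive sequences have Hamming distance at most $d$ and the positions where they differ are adjacent. -}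

module Defs where

open import Data.Nat using (ℕ; zero; suc; _+_; _∸_; _≤_; _<_; _⊔_; _<?_; _%_)
open import Data.Nat.Properties using (_≟_)
open import Data.Fin using (Fin; toℕ)
open import Data.Vec using (Vec; lookup; toList)
open import Data.List using (List; []; _∷_; take; drop; length)
open import Data.Nat.ListAction using (sum)
open import Data.Product using (_×_; Σ; ∃)
open import Data.Sum using (_⊎_)
open import Relation.Binary.PropositionalEquality using (_≡_; _≢_)
open import Relation.Nullary using (¬_; does)
open import Data.Bool using (if_then_else_)

-- Sequences s₁…sₙ are represented as Vec ℕ n; position i (1-based in the
-- paper) is the index Fin n with toℕ = i - 1.

asc : List ℕ → ℕ
asc [] = 0
asc (x ∷ []) = 0
asc (x ∷ y ∷ rest) = (if does (x <? y) then 1 else 0) + asc (y ∷ rest)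

maxL : List ℕ → ℕ
maxL [] = 0
maxL (x ∷ xs) = x ⊔ maxL xs

-- Generic restricted-growth condition with respect to a statistic:
-- s₁ = 0 and s_{k+1} ≤ stat(s₁…s_k) + 1 for 1 ≤ k < n.
-- Index (suc i) : Fin (suc m) is position k+1 where k = toℕ i + 1.
Growth : (List ℕ → ℕ) → {m : ℕ} → Vec ℕ (suc m) → Set
Growth stat {m} s =
  (lookup s Fin.zero ≡ 0) ×
  ((i : Fin m) → lookup s (Fin.suc i) ≤ stat (take (suc (toℕ i)) (toList s)) + 1)

-- A_n (ascent sequences) and R_n (restricted growth sequences), n = suc m
InA : {m : ℕ} → Vec ℕ (suc m) → Set
InA = Growth asc

InR : {m : ℕ} → Vec ℕ (suc m) → Set
InR = Growth maxL

suffixWeight : {n : ℕ} → Vec ℕ n → Fin n → ℕ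
suffixWeight {n} s k =
  sum (drop (suc (toℕ k)) (toList s)) + (n ∸ suc (toℕ k))

_≺c_ : {n : ℕ} → Vec ℕ n → Vec ℕ n → Set
_≺c_ {n} s t = Σ (Fin n) λ k →
  (lookup s k ≢ lookup t k) ×
  ((j : Fin n) → toℕ k Data.Nat.< toℕ j → lookup s j ≡ lookup t j) ×
  ( ((suffixWeight s k % 2 ≡ 0) × (lookup t k < lookup s k))
  ⊎ ((suffixWeight s k % 2 ≡ 1) × (lookup s k < lookup t k)))

hammingL : List ℕ → List ℕ → ℕ
hammingL [] _ = 0
hammingL (_ ∷ _) [] = 0
hammingL (x ∷ xs) (y ∷ ys) = (if does (x ≟ y) then 0 else 1) + hammingL xs ys

hamming : {n : ℕ} → Vec ℕ n → Vec ℕ n → ℕ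
hamming s t = hammingL (toList s) (toList t)

DiffAdjacent : {n : ℕ} → Vec ℕ n → Vec ℕ n → Set
DiffAdjacent {n} s t = (i j k : Fin n) → toℕ i < toℕ j → toℕ j < toℕ k →
  lookup s i ≢ lookup t i → lookup s k ≢ lookup t k → lookup s j ≢ lookup t j

DAdjacent : ℕ → {n : ℕ} → Vec ℕ n → Vec ℕ n → Set
DAdjacent d s t = (hamming s t ≤ d) × DiffAdjacent s t

IsDAdjacentGrayCode : ℕ → {n : ℕ} → (Vec ℕ n → Set) → Set
IsDAdjacentGrayCode d {n} X = (s t : Vec ℕ n) → X s → X t → s ≺c t →
  ¬ (Σ (Vec ℕ n) λ u → X u × s ≺c u × u ≺c t) → DAdjacent d s t

-- Let s ≺c t be consecutive, with k the rightmost position where they differ. If they also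
-- differed at some j < k - 1, one of them, say s, leaves the staircase 0, 1, 2, … before k - 1;
-- at its first deviation p we have s_p < p. Raising s_p to p and replacing s_{p+1} by itself,
-- by p + 1, or by s_{p+1} - 1 keeps the sequence in A_n (resp. R_n), because asc (resp. max) of
-- every longer prefix can only grow. For the right one of these choices, dictated by the
-- parities of the suffix weights at p and p + 1, the new sequence lies strictly between s and t,
-- since it agrees with s beyond p + 1 < k. So s and t differ only at k - 1 and k.
module Submission where

open import Defs
open import Data.Bool using (if_then_else_)
open import Data.Empty using (⊥; ⊥-elim)
open import Data.Fin using (Fin; toℕ; fromℕ<)
open import Data.Fin.Properties using (toℕ-fromℕ<; toℕ<n)
open import Data.List using (List; []; _∷_; take; drop; _++_)
open import Data.Nat using (ℕ; zero; suc; _+_; _∸_; _≤_; _<_; _⊔_; _<?_; _%_; z≤n; s≤s; z<s)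
open import Data.Nat.ListAction using (sum)
open import Data.Nat.Properties
open import Data.Product using (_×_; Σ; _,_; proj₁; proj₂)
open import Data.Sum using (_⊎_; inj₁; inj₂; [_,_])
open import Data.Vec using (Vec; []; _∷_; lookup; toList)
open import Function using (_∘_)
open import Relation.Binary.Definitions using (tri<; tri≈; tri>)
open import Relation.Binary.PropositionalEquality hiding ([_])
open import Relation.Nullary using (¬_; does; yes; no)
open import Relation.Nullary.Decidable using (dec-true; dec-false)

segment : (ℕ → ℕ) → ℕ → ℕ → List ℕ
segment f a zero    = []
segment f a (suc d) = f a ∷ segment f (suc a) d

-- Out-of-range entries are 0.
entry : ∀ {n} → Vec ℕ n → ℕ → ℕ
entry []       j       = 0
entry (x ∷ xs) zero    = x
entry (x ∷ xs) (suc j) = entry xs j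

fromFunction : ∀ n → (ℕ → ℕ) → Vec ℕ n
fromFunction zero    h = []
fromFunction (suc n) h = h 0 ∷ fromFunction n (h ∘ suc)

lookup≡entry : ∀ {n} (s : Vec ℕ n) (i : Fin n) → lookup s i ≡ entry s (toℕ i)
lookup≡entry (x ∷ s) Fin.zero    = refl
lookup≡entry (x ∷ s) (Fin.suc i) = lookup≡entry s i

entry-fromFunction : ∀ n h {j} → j < n → entry (fromFunction n h) j ≡ h j
entry-fromFunction (suc n) h {zero}  _         = refl
entry-fromFunction (suc n) h {suc j} (s≤s j<n) = entry-fromFunction n (h ∘ suc) j<n

range-tail : ∀ {P : ℕ → Set} a d → (∀ j → a ≤ j → j < a + suc d → P j) →
  ∀ j → suc a ≤ j → j < suc a + d → P j
range-tail a d P-range j a<j j< = P-range j (<⇒≤ a<j) (subst (j <_) (sym (+-suc a d)) j<)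

segment-suc : ∀ f a d → segment f (suc a) d ≡ segment (f ∘ suc) a d
segment-suc f a zero    = refl
segment-suc f a (suc d) = cong (f (suc a) ∷_) (segment-suc f (suc a) d)

segment-cong : ∀ {f g} a d → (∀ j → a ≤ j → j < a + d → f j ≡ g j) →
  segment f a d ≡ segment g a d
segment-cong a zero    f≐g = refl
segment-cong a (suc d) f≐g =
  cong₂ _∷_ (f≐g a ≤-refl (m<m+n a z<s))
    (segment-cong (suc a) d (range-tail a d f≐g))

segment-++ : ∀ f a d e → segment f a (d + e) ≡ segment f a d ++ segment f (a + d) e
segment-++ f a zero    e = cong (λ b → segment f b e) (sym (+-identityʳ a))
segment-++ f a (suc d) e =
  cong (f a ∷_) (trans (segment-++ f (suc a) d e)
    (cong (λ b → segment f (suc a) d ++ segment f b e) (sym (+-suc a d))))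

take-segment : ∀ f a {d e} → d ≤ e → take d (segment f a e) ≡ segment f a d
take-segment f a {zero}           _         = refl
take-segment f a {suc d} {suc e} (s≤s d≤e) = cong (f a ∷_) (take-segment f (suc a) d≤e)

drop-segment : ∀ f a d e → drop d (segment f a e) ≡ segment f (a + d) (e ∸ d)
drop-segment f a zero    e       = cong (λ b → segment f b e) (sym (+-identityʳ a))
drop-segment f a (suc d) zero    = refl
drop-segment f a (suc d) (suc e) =
  trans (drop-segment f (suc a) d e) (cong (λ b → segment f b (e ∸ d)) (sym (+-suc a d)))

toList≡segment : ∀ {n} (s : Vec ℕ n) → toList s ≡ segment (entry s) 0 n
toList≡segment []      = refl
toList≡segment (x ∷ s) = cong (x ∷_) (trans (toList≡segment s) (sym (segment-suc (entry (x ∷ s)) 0 _)))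

take-toList : ∀ {n} (s : Vec ℕ n) {d} → d ≤ n → take d (toList s) ≡ segment (entry s) 0 d
take-toList s d≤n = trans (cong (take _) (toList≡segment s)) (take-segment (entry s) 0 d≤n)

drop-toList : ∀ {n} (s : Vec ℕ n) d → drop d (toList s) ≡ segment (entry s) d (n ∸ d)
drop-toList {n} s d = trans (cong (drop d) (toList≡segment s)) (drop-segment (entry s) 0 d n)

suffixWeightℕ : ℕ → (ℕ → ℕ) → ℕ → ℕ
suffixWeightℕ n f k = sum (segment f (suc k) (n ∸ suc k)) + (n ∸ suc k)

Oriented : ℕ → ℕ → ℕ → Set
Oriented w x y = (w % 2 ≡ 0 × y < x) ⊎ (w % 2 ≡ 1 × x < y)

_≺[_]_ : (ℕ → ℕ) → ℕ → (ℕ → ℕ) → Set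
f ≺[ n ] g = Σ ℕ λ k → k < n × (∀ j → k < j → j < n → f j ≡ g j) ×
  Oriented (suffixWeightℕ n f k) (f k) (g k)

GrowthFun : (List ℕ → ℕ) → ℕ → (ℕ → ℕ) → Set
GrowthFun stat n f = f 0 ≡ 0 × (∀ i → suc i < n → f (suc i) ≤ stat (segment f 0 (suc i)) + 1)

oriented-≢ : ∀ {w x y} → Oriented w x y → x ≢ y
oriented-≢ (inj₁ (_ , y<x)) x≡y = <⇒≢ y<x (sym x≡y)
oriented-≢ (inj₂ (_ , x<y)) x≡y = <⇒≢ x<y x≡y

oriented-resp : ∀ {w w′ x x′ y y′} → w ≡ w′ → x ≡ x′ → y ≡ y′ → Oriented w x y → Oriented w′ x′ y′
oriented-resp refl refl refl o = o

suffixWeightℕ-cong : ∀ n {f g} k → k < n → (∀ j → k < j → j < n → f j ≡ g j) →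
  suffixWeightℕ n f k ≡ suffixWeightℕ n g k
suffixWeightℕ-cong n k k<n f≐g = cong (λ l → sum l + (n ∸ suc k))
  (segment-cong (suc k) (n ∸ suc k) λ j k<j j<n → f≐g j k<j (subst (j <_) (m+[n∸m]≡n k<n) j<n))

≺[]-congˡ : ∀ {n f g h} (f≺g : f ≺[ n ] g) → (∀ j → proj₁ f≺g ≤ j → j < n → h j ≡ f j) → h ≺[ n ] g
≺[]-congˡ {n} (k , k<n , f≐g , oriented) h≐f =
  k , k<n , (λ j k<j j<n → trans (h≐f j (<⇒≤ k<j) j<n) (f≐g j k<j j<n)) ,
  oriented-resp (suffixWeightℕ-cong n k k<n λ j k<j j<n → sym (h≐f j (<⇒≤ k<j) j<n))
    (sym (h≐f k ≤-refl k<n)) refl oriented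

≺[]-congʳ : ∀ {n f g h} (f≺g : f ≺[ n ] g) → (∀ j → proj₁ f≺g ≤ j → j < n → h j ≡ g j) → f ≺[ n ] h
≺[]-congʳ {n} {f} (k , k<n , f≐g , oriented) h≐g =
  k , k<n , (λ j k<j j<n → trans (f≐g j k<j j<n) (sym (h≐g j (<⇒≤ k<j) j<n))) ,
  oriented-resp {suffixWeightℕ n f k} refl refl (sym (h≐g k ≤-refl k<n)) oriented

≺c⇒≺[] : ∀ {n} (s t : Vec ℕ n) → s ≺c t → entry s ≺[ n ] entry t
≺c⇒≺[] {n} s t (k , _ , s≐t , oriented) =
  toℕ k , toℕ<n k , agree ,
  oriented-resp {suffixWeight s k} (cong (λ l → sum l + (n ∸ suc (toℕ k))) (drop-toList s (suc (toℕ k))))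
    (lookup≡entry s k) (lookup≡entry t k) oriented
  where
  agree : ∀ j → toℕ k < j → j < n → entry s j ≡ entry t j
  agree j k<j j<n = begin
    entry s j                  ≡⟨ cong (entry s) (toℕ-fromℕ< j<n) ⟨
    entry s (toℕ (fromℕ< j<n)) ≡⟨ lookup≡entry s (fromℕ< j<n) ⟨
    lookup s (fromℕ< j<n)      ≡⟨ s≐t (fromℕ< j<n) (subst (toℕ k <_) (sym (toℕ-fromℕ< j<n)) k<j) ⟩
    lookup t (fromℕ< j<n)      ≡⟨ lookup≡entry t (fromℕ< j<n) ⟩
    entry t (toℕ (fromℕ< j<n)) ≡⟨ cong (entry t) (toℕ-fromℕ< j<n) ⟩
    entry t j                  ∎
    where open ≡-Reasoning

≺[]⇒≺c : ∀ {n} (s t : Vec ℕ n) → entry s ≺[ n ] entry t → s ≺c t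
≺[]⇒≺c {n} s t (k , k<n , s≐t , oriented) =
  k′ , oriented-≢ {suffixWeight s k′} oriented′ ,
  (λ j k′<j → trans (lookup≡entry s j)
                 (trans (s≐t (toℕ j) (subst (_< toℕ j) k′≡k k′<j) (toℕ<n j)) (sym (lookup≡entry t j)))) ,
  oriented′
  where
  k′ : Fin n
  k′ = fromℕ< k<n
  k′≡k : toℕ k′ ≡ k
  k′≡k = toℕ-fromℕ< k<n
  at-k′ : (v : Vec ℕ n) → entry v k ≡ lookup v k′
  at-k′ v = sym (trans (lookup≡entry v k′) (cong (entry v) k′≡k))
  oriented′ : Oriented (suffixWeight s k′) (lookup s k′) (lookup t k′)
  oriented′ = oriented-resp {suffixWeightℕ n (entry s) k}
    (sym (trans (cong (λ l → sum l + (n ∸ suc (toℕ k′))) (drop-toList s (suc (toℕ k′))))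
                (cong (suffixWeightℕ n (entry s)) k′≡k)))
    (at-k′ s) (at-k′ t) oriented

growth⇒growthFun : ∀ stat {m} (s : Vec ℕ (suc m)) → Growth stat s → GrowthFun stat (suc m) (entry s)
growth⇒growthFun stat {m} s (s₀≡0 , grows) = trans (sym (lookup≡entry s Fin.zero)) s₀≡0 , grows′
  where
  grows′ : ∀ i → suc i < suc m → entry s (suc i) ≤ stat (segment (entry s) 0 (suc i)) + 1
  grows′ i (s≤s i<m) = subst₂ (λ x l → x ≤ stat l + 1) entry-eq prefix-eq (grows (fromℕ< i<m))
    where
    entry-eq : lookup s (Fin.suc (fromℕ< i<m)) ≡ entry s (suc i)
    entry-eq = trans (lookup≡entry s _) (cong (entry s ∘ suc) (toℕ-fromℕ< i<m))
    prefix-eq : take (suc (toℕ (fromℕ< i<m))) (toList s) ≡ segment (entry s) 0 (suc i)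
    prefix-eq = trans (cong (λ d → take (suc d) (toList s)) (toℕ-fromℕ< i<m)) (take-toList s (s≤s (<⇒≤ i<m)))

growthFun⇒growth : ∀ stat {m} (s : Vec ℕ (suc m)) → GrowthFun stat (suc m) (entry s) → Growth stat s
growthFun⇒growth stat s (s₀≡0 , grows) = trans (lookup≡entry s Fin.zero) s₀≡0 , λ i →
  subst₂ (λ x l → x ≤ stat l + 1) (sym (lookup≡entry s (Fin.suc i)))
    (sym (take-toList s (s≤s (<⇒≤ (toℕ<n i))))) (grows (toℕ i) (s≤s (toℕ<n i)))

growthFun-cong : ∀ {stat m f g} → GrowthFun stat (suc m) f → (∀ j → j < suc m → g j ≡ f j) →
  GrowthFun stat (suc m) g
growthFun-cong {stat} (f₀≡0 , grows) g≐f = trans (g≐f 0 z<s) f₀≡0 , λ i i<m →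
  subst₂ (λ x l → x ≤ stat l + 1) (sym (g≐f (suc i) i<m))
    (segment-cong 0 (suc i) λ j _ j≤i → sym (g≐f j (<-trans j≤i i<m))) (grows i i<m)

Staircase : (ℕ → ℕ) → ℕ → Set
Staircase f q = ∀ j → j ≤ q → f j ≡ j

-- The two properties of asc and max that the argument uses: their value on a staircase prefix
-- 0, 1, …, q, and that raising the first deviation from the staircase (see `raise`) does not
-- decrease them on longer prefixes.
record StaircaseStatistic (stat : List ℕ → ℕ) : Set where
  field
    staircase-value : ∀ f q → Staircase f q → stat (segment f 0 (suc q)) ≡ q
    staircase-then-lower : ∀ f q → Staircase f q → f (suc q) ≤ q → stat (segment f 0 (2 + q)) ≤ q
    raise-dominates : ∀ f g q r → Staircase f q → Staircase g (suc q) →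
      f (suc q) ≤ q → f (2 + q) ≤ suc q → g (2 + q) ≤ f (2 + q) ⊎ g (2 + q) ≡ 2 + q →
      (∀ j → 2 + q < j → f j ≡ g j) →
      stat (segment f 0 (3 + q + r)) ≤ stat (segment g 0 (3 + q + r))

ascent : ℕ → ℕ → ℕ
ascent x y = if does (x <? y) then 1 else 0

ascent-< : ∀ {x y} → x < y → ascent x y ≡ 1
ascent-< {x} {y} x<y rewrite dec-true (x <? y) x<y = refl

ascent-≮ : ∀ {x y} → ¬ x < y → ascent x y ≡ 0
ascent-≮ {x} {y} x≮y rewrite dec-false (x <? y) x≮y = refl

ascent≤1 : ∀ x y → ascent x y ≤ 1
ascent≤1 x y with x <? y
... | yes x<y = ≤-reflexive (ascent-< x<y)
... | no  x≮y = ≤-trans (≤-reflexive (ascent-≮ x≮y)) z≤n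

ascent-antitoneˡ : ∀ {x x′} y → x′ ≤ x → ascent x y ≤ ascent x′ y
ascent-antitoneˡ {x} {x′} y x′≤x with x <? y
... | no  x≮y = ≤-trans (≤-reflexive (ascent-≮ x≮y)) z≤n
... | yes x<y = ≤-reflexive (trans (ascent-< x<y) (sym (ascent-< (≤-<-trans x′≤x x<y))))

-- The number of ascents of h a, h (a + 1), …, h (a + d).
ascents : (ℕ → ℕ) → ℕ → ℕ → ℕ
ascents h a zero    = 0
ascents h a (suc d) = ascent (h a) (h (suc a)) + ascents h (suc a) d

asc-segment : ∀ h a d → asc (segment h a (suc d)) ≡ ascents h a d
asc-segment h a zero    = refl
asc-segment h a (suc d) = cong (ascent (h a) (h (suc a)) +_) (asc-segment h (suc a) d)

ascents-+ : ∀ h a d e → ascents h a (d + e) ≡ ascents h a d + ascents h (a + d) e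
ascents-+ h a zero    e = cong (λ b → ascents h b e) (sym (+-identityʳ a))
ascents-+ h a (suc d) e = begin
  ascent (h a) (h (suc a)) + ascents h (suc a) (d + e)
    ≡⟨ cong (ascent (h a) (h (suc a)) +_) (ascents-+ h (suc a) d e) ⟩
  ascent (h a) (h (suc a)) + (ascents h (suc a) d + ascents h (suc a + d) e)
    ≡⟨ +-assoc (ascent (h a) (h (suc a))) _ _ ⟨
  ascents h a (suc d) + ascents h (suc a + d) e
    ≡⟨ cong (λ b → ascents h a (suc d) + ascents h b e) (+-suc a d) ⟨
  ascents h a (suc d) + ascents h (a + suc d) e ∎
  where open ≡-Reasoning

ascents-snoc : ∀ h a d → ascents h a (suc d) ≡ ascents h a d + ascent (h (a + d)) (h (suc (a + d)))
ascents-snoc h a d = begin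
  ascents h a (suc d)      ≡⟨ cong (ascents h a) (+-comm 1 d) ⟩
  ascents h a (d + 1)      ≡⟨ ascents-+ h a d 1 ⟩
  ascents h a d + ascents h (a + d) 1 ≡⟨ cong (ascents h a d +_) (+-identityʳ _) ⟩
  ascents h a d + ascent (h (a + d)) (h (suc (a + d))) ∎
  where open ≡-Reasoning

ascents-cong : ∀ {f g} a d → (∀ j → a ≤ j → f j ≡ g j) → ascents f a d ≡ ascents g a d
ascents-cong a zero    f≐g = refl
ascents-cong a (suc d) f≐g =
  cong₂ _+_ (cong₂ ascent (f≐g a ≤-refl) (f≐g (suc a) (n≤1+n a)))
    (ascents-cong (suc a) d λ j a<j → f≐g j (<⇒≤ a<j))

ascents-staircase : ∀ h q → Staircase h q → ascents h 0 q ≡ q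
ascents-staircase h zero    stair = refl
ascents-staircase h (suc q) stair = begin
  ascents h 0 (suc q)                       ≡⟨ ascents-snoc h 0 q ⟩
  ascents h 0 q + ascent (h q) (h (suc q))  ≡⟨ cong₂ _+_ (ascents-staircase h q λ j j≤q → stair j (m≤n⇒m≤1+n j≤q))
                                                          (cong₂ ascent (stair q (n≤1+n q)) (stair (suc q) ≤-refl)) ⟩
  q + ascent q (suc q)                      ≡⟨ cong (q +_) (ascent-< (n<1+n q)) ⟩
  q + 1                                     ≡⟨ +-comm q 1 ⟩
  suc q                                     ∎
  where open ≡-Reasoning

ascents-staircase-then-lower : ∀ h q → Staircase h q → h (suc q) ≤ q → ascents h 0 (suc q) ≡ q
ascents-staircase-then-lower h q stair h₁≤q = begin
  ascents h 0 (suc q)                       ≡⟨ ascents-snoc h 0 q ⟩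
  ascents h 0 q + ascent (h q) (h (suc q))  ≡⟨ cong₂ _+_ (ascents-staircase h q stair) (ascent-≮ no-ascent) ⟩
  q + 0                                     ≡⟨ +-identityʳ q ⟩
  q                                         ∎
  where
  open ≡-Reasoning
  no-ascent : ¬ h q < h (suc q)
  no-ascent hq<h₁ = <⇒≱ (subst (_< h (suc q)) (stair q ≤-refl) hq<h₁) h₁≤q

ascents-from-lowered : ∀ {f g} a r → g a ≤ f a → (∀ j → a < j → f j ≡ g j) → ascents f a r ≤ ascents g a r
ascents-from-lowered a zero    _     _   = z≤n
ascents-from-lowered {f} {g} a (suc r) g≤f f≐g rewrite f≐g (suc a) ≤-refl =
  +-mono-≤ (ascent-antitoneˡ (g (suc a)) g≤f)
    (≤-reflexive (ascents-cong (suc a) r f≐g))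

ascents-from-changed : ∀ {f g} a r → (∀ j → a < j → f j ≡ g j) → ascents f a r ≤ 1 + ascents g a r
ascents-from-changed a zero    _   = z≤n
ascents-from-changed {f} {g} a (suc r) f≐g =
  +-mono-≤ (ascent≤1 (f a) (f (suc a)))
    (≤-trans (≤-reflexive (ascents-cong (suc a) r f≐g)) (m≤n+m _ _))

ascStatistic : StaircaseStatistic asc
ascStatistic = record
  { staircase-value = value ; staircase-then-lower = then-lower ; raise-dominates = dominates }
  where
  open ≤-Reasoning

  value : ∀ f q → Staircase f q → asc (segment f 0 (suc q)) ≡ q
  value f q stair = trans (asc-segment f 0 q) (ascents-staircase f q stair)

  then-lower : ∀ f q → Staircase f q → f (suc q) ≤ q → asc (segment f 0 (2 + q)) ≤ q
  then-lower f q stair f₁≤q =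
    ≤-reflexive (trans (asc-segment f 0 (suc q)) (ascents-staircase-then-lower f q stair f₁≤q))

  dominates : ∀ f g q r → Staircase f q → Staircase g (suc q) →
    f (suc q) ≤ q → f (2 + q) ≤ suc q → g (2 + q) ≤ f (2 + q) ⊎ g (2 + q) ≡ 2 + q →
    (∀ j → 2 + q < j → f j ≡ g j) →
    asc (segment f 0 (3 + q + r)) ≤ asc (segment g 0 (3 + q + r))
  dominates f g q r stair-f stair-g f₁≤q _ choice f≐g = begin
    asc (segment f 0 (3 + q + r))              ≡⟨ split f ⟩
    ascents f 0 (2 + q) + ascents f (2 + q) r  ≤⟨ heads-and-tails choice ⟩
    ascents g 0 (2 + q) + ascents g (2 + q) r  ≡⟨ split g ⟨
    asc (segment g 0 (3 + q + r))              ∎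
    where
    split : ∀ h → asc (segment h 0 (3 + q + r)) ≡ ascents h 0 (2 + q) + ascents h (2 + q) r
    split h = trans (asc-segment h 0 (2 + q + r)) (ascents-+ h 0 (2 + q) r)

    head-f : ascents f 0 (2 + q) ≤ suc q
    head-f = begin
      ascents f 0 (2 + q)
        ≡⟨ ascents-snoc f 0 (suc q) ⟩
      ascents f 0 (suc q) + ascent (f (suc q)) (f (2 + q))
        ≡⟨ cong (_+ ascent (f (suc q)) (f (2 + q))) (ascents-staircase-then-lower f q stair-f f₁≤q) ⟩
      q + ascent (f (suc q)) (f (2 + q))
        ≤⟨ +-monoʳ-≤ q (ascent≤1 (f (suc q)) (f (2 + q))) ⟩
      q + 1
        ≡⟨ +-comm q 1 ⟩
      suc q ∎

    head-g : ascents g 0 (2 + q) ≡ suc q + ascent (suc q) (g (2 + q))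
    head-g = trans (ascents-snoc g 0 (suc q))
      (cong₂ (λ x y → x + ascent y (g (2 + q))) (ascents-staircase g (suc q) stair-g) (stair-g (suc q) ≤-refl))

    heads-and-tails : g (2 + q) ≤ f (2 + q) ⊎ g (2 + q) ≡ 2 + q →
      ascents f 0 (2 + q) + ascents f (2 + q) r ≤ ascents g 0 (2 + q) + ascents g (2 + q) r
    heads-and-tails (inj₁ lowered) =
      +-mono-≤ (≤-trans head-f (≤-trans (m≤m+n (suc q) _) (≤-reflexive (sym head-g))))
        (ascents-from-lowered (2 + q) r lowered f≐g)
    heads-and-tails (inj₂ raised) = begin
      ascents f 0 (2 + q) + ascents f (2 + q) r
        ≤⟨ +-mono-≤ head-f (ascents-from-changed (2 + q) r f≐g) ⟩
      suc q + (1 + ascents g (2 + q) r)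
        ≡⟨ +-assoc (suc q) 1 _ ⟨
      suc q + 1 + ascents g (2 + q) r
        ≡⟨ cong (λ x → suc q + x + ascents g (2 + q) r) (ascent-< suc-q<) ⟨
      suc q + ascent (suc q) (g (2 + q)) + ascents g (2 + q) r
        ≡⟨ cong (_+ ascents g (2 + q) r) head-g ⟨
      ascents g 0 (2 + q) + ascents g (2 + q) r ∎
      where
      suc-q< : suc q < g (2 + q)
      suc-q< = subst (suc q <_) (sym raised) ≤-refl

maxL-++ : ∀ l l′ → maxL (l ++ l′) ≡ maxL l ⊔ maxL l′
maxL-++ []      l′ = refl
maxL-++ (x ∷ l) l′ = trans (cong (x ⊔_) (maxL-++ l l′)) (sym (⊔-assoc x (maxL l) (maxL l′)))

maxL-segment-≤ : ∀ f a d {c} → (∀ j → a ≤ j → j < a + d → f j ≤ c) → maxL (segment f a d) ≤ c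
maxL-segment-≤ f a zero    _     = z≤n
maxL-segment-≤ f a (suc d) f≤c = ⊔-lub (f≤c a ≤-refl (m<m+n a z<s))
  (maxL-segment-≤ f (suc a) d (range-tail a d f≤c))

≤-maxL-segment : ∀ f a d {j} → a ≤ j → j < a + d → f j ≤ maxL (segment f a d)
≤-maxL-segment f a zero    {j} a≤j j< = ⊥-elim (<⇒≱ (subst (j <_) (+-identityʳ a) j<) a≤j)
≤-maxL-segment f a (suc d) {j} a≤j j< with m≤n⇒m<n∨m≡n a≤j
... | inj₂ refl = m≤m⊔n (f a) _
... | inj₁ a<j  = ≤-trans (≤-maxL-segment f (suc a) d a<j (subst (j <_) (+-suc a d) j<)) (m≤n⊔m (f a) _)

≤-suc-cases : ∀ {j q} → j ≤ suc q → j ≤ q ⊎ j ≡ suc q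
≤-suc-cases j≤1+q with m≤n⇒m<n∨m≡n j≤1+q
... | inj₁ j<1+q = inj₁ (≤-pred j<1+q)
... | inj₂ j≡1+q = inj₂ j≡1+q

maxStatistic : StaircaseStatistic maxL
maxStatistic = record
  { staircase-value = value ; staircase-then-lower = then-lower ; raise-dominates = dominates }
  where
  stair-below : ∀ f q → Staircase f q → ∀ j → j ≤ q → f j ≤ q
  stair-below f q stair j j≤q = ≤-trans (≤-reflexive (stair j j≤q)) j≤q

  value : ∀ f q → Staircase f q → maxL (segment f 0 (suc q)) ≡ q
  value f q stair = ≤-antisym
    (maxL-segment-≤ f 0 (suc q) λ j _ j<1+q → stair-below f q stair j (≤-pred j<1+q))
    (subst (_≤ maxL (segment f 0 (suc q))) (stair q ≤-refl) (≤-maxL-segment f 0 (suc q) z≤n ≤-refl))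

  then-lower : ∀ f q → Staircase f q → f (suc q) ≤ q → maxL (segment f 0 (2 + q)) ≤ q
  then-lower f q stair f₁≤q = maxL-segment-≤ f 0 (2 + q) λ j _ j<2+q → bound (≤-suc-cases (≤-pred j<2+q))
    where
    bound : ∀ {j} → j ≤ q ⊎ j ≡ suc q → f j ≤ q
    bound (inj₁ j≤q)  = stair-below f q stair _ j≤q
    bound (inj₂ refl) = f₁≤q

  dominates : ∀ f g q r → Staircase f q → Staircase g (suc q) →
    f (suc q) ≤ q → f (2 + q) ≤ suc q → g (2 + q) ≤ f (2 + q) ⊎ g (2 + q) ≡ 2 + q →
    (∀ j → 2 + q < j → f j ≡ g j) →
    maxL (segment f 0 (3 + q + r)) ≤ maxL (segment g 0 (3 + q + r))
  dominates f g q r stair-f stair-g f₁≤q f₂≤1+q _ f≐g = begin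
    maxL (segment f 0 (3 + q + r))                           ≡⟨ split f ⟩
    maxL (segment f 0 (3 + q)) ⊔ maxL (segment f (3 + q) r)  ≤⟨ ⊔-mono-≤ (≤-trans head-f head-g) (≤-reflexive tails) ⟩
    maxL (segment g 0 (3 + q)) ⊔ maxL (segment g (3 + q) r)  ≡⟨ split g ⟨
    maxL (segment g 0 (3 + q + r))                           ∎
    where
    open ≤-Reasoning

    split : ∀ h → maxL (segment h 0 (3 + q + r)) ≡ maxL (segment h 0 (3 + q)) ⊔ maxL (segment h (3 + q) r)
    split h = trans (cong maxL (segment-++ h 0 (3 + q) r)) (maxL-++ (segment h 0 (3 + q)) (segment h (3 + q) r))

    tails : maxL (segment f (3 + q) r) ≡ maxL (segment g (3 + q) r)
    tails = cong maxL (segment-cong (3 + q) r λ j 2+q<j _ → f≐g j 2+q<j)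

    bound : ∀ {j} → j ≤ suc q ⊎ j ≡ 2 + q → f j ≤ suc q
    bound (inj₁ j≤1+q) with ≤-suc-cases j≤1+q
    ... | inj₁ j≤q  = m≤n⇒m≤1+n (stair-below f q stair-f _ j≤q)
    ... | inj₂ refl = m≤n⇒m≤1+n f₁≤q
    bound (inj₂ refl) = f₂≤1+q

    head-f : maxL (segment f 0 (3 + q)) ≤ suc q
    head-f = maxL-segment-≤ f 0 (3 + q) λ j _ j<3+q → bound (≤-suc-cases (≤-pred j<3+q))

    head-g : suc q ≤ maxL (segment g 0 (3 + q))
    head-g = subst (_≤ maxL (segment g 0 (3 + q))) (stair-g (suc q) ≤-refl)
      (≤-maxL-segment g 0 (3 + q) z≤n (s≤s (s≤s (n≤1+n q))))

raise : (ℕ → ℕ) → ℕ → ℕ → ℕ → ℕ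
raise f p a j = if does (j ≟ p) then p else if does (j ≟ suc p) then a else f j

raise-at : ∀ f p a → raise f p a p ≡ p
raise-at f p a rewrite dec-true (p ≟ p) refl = refl

raise-next : ∀ f p a → raise f p a (suc p) ≡ a
raise-next f p a
  rewrite dec-false (suc p ≟ p) (λ 1+p≡p → <⇒≢ (n<1+n p) (sym 1+p≡p))
        | dec-true (suc p ≟ suc p) refl = refl

raise-elsewhere : ∀ f p a {j} → j ≢ p → j ≢ suc p → raise f p a j ≡ f j
raise-elsewhere f p a {j} j≢p j≢1+p rewrite dec-false (j ≟ p) j≢p | dec-false (j ≟ suc p) j≢1+p = refl

%2-suc : ∀ x → suc x % 2 ≢ x % 2
%2-suc zero          ()
%2-suc (suc zero)    ()
%2-suc (suc (suc x)) = %2-suc x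

parity : ∀ x → x % 2 ≡ 0 ⊎ x % 2 ≡ 1
parity zero          = inj₁ refl
parity (suc zero)    = inj₂ refl
parity (suc (suc x)) = parity x

suffixWeightℕ-step : ∀ n f k → suc k < n →
  suffixWeightℕ n f k ≡ f (suc k) + suc (suffixWeightℕ n f (suc k))
suffixWeightℕ-step n f k 1+k<n with n ∸ suc k | +-∸-assoc 1 1+k<n
... | _ | refl = trans (+-assoc (f (suc k)) _ _) (cong (f (suc k) +_) (+-suc _ _))

precedes-at : ∀ {n f g} k → k < n → (∀ j → k < j → g j ≡ f j) →
  Oriented (suffixWeightℕ n f k) (f k) (g k) → f ≺[ n ] g
precedes-at k k<n g≐f oriented = k , k<n , (λ j k<j _ → sym (g≐f j k<j)) , oriented

preceded-at : ∀ {n f g} k → k < n → (∀ j → k < j → g j ≡ f j) →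
  Oriented (suffixWeightℕ n f k) (g k) (f k) → g ≺[ n ] f
preceded-at {n} {f} k k<n g≐f oriented =
  k , k<n , (λ j k<j _ → g≐f j k<j) ,
  oriented-resp {suffixWeightℕ n f k} (suffixWeightℕ-cong n k k<n λ j k<j _ → sym (g≐f j k<j)) refl refl oriented

module FirstDeviation {stat} (isStat : StaircaseStatistic stat) {n f} (growth : GrowthFun stat n f)
  (q : ℕ) (2+q<n : 2 + q < n) (stair : Staircase f q) (deviates : f (suc q) ≢ suc q) where
  open StaircaseStatistic isStat

  1+q<n : suc q < n
  1+q<n = <⇒≤ 2+q<n

  deviation-below : f (suc q) ≤ q
  deviation-below = ≤-pred (≤∧≢⇒< at-most-1+q deviates)
    where
    at-most-1+q : f (suc q) ≤ suc q
    at-most-1+q = subst (f (suc q) ≤_) (trans (cong (_+ 1) (staircase-value f q stair)) (+-comm q 1))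
      (proj₂ growth q 1+q<n)

  next-below : f (2 + q) ≤ suc q
  next-below = subst (f (2 + q) ≤_) (+-comm q 1)
    (≤-trans (proj₂ growth (suc q) 2+q<n) (+-monoˡ-≤ 1 (staircase-then-lower f q stair deviation-below)))

  module Raised (a : ℕ) (lowered-or-top : a ≤ f (2 + q) ⊎ a ≡ 2 + q) where
    g : ℕ → ℕ
    g = raise f (suc q) a

    g-below : ∀ j → j ≤ q → g j ≡ f j
    g-below j j≤q = raise-elsewhere f (suc q) a (<⇒≢ (s≤s j≤q)) (<⇒≢ (s≤s (m≤n⇒m≤1+n j≤q)))

    g-staircase : Staircase g (suc q)
    g-staircase j j≤1+q with ≤-suc-cases j≤1+q
    ... | inj₁ j≤q  = trans (g-below j j≤q) (stair j j≤q)
    ... | inj₂ refl = raise-at f (suc q) a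

    g-beyond : ∀ j → 2 + q < j → g j ≡ f j
    g-beyond j 2+q<j = raise-elsewhere f (suc q) a (λ { refl → <⇒≱ 2+q<j (n≤1+n _) }) (λ { refl → <-irrefl refl 2+q<j })

    growth-raised : GrowthFun stat n g
    growth-raised = trans (g-below 0 z≤n) (proj₁ growth) , grows
      where
      open ≤-Reasoning

      a≤2+q : a ≤ 2 + q
      a≤2+q = [ (λ a≤f₂ → ≤-trans a≤f₂ (m≤n⇒m≤1+n next-below)) , ≤-reflexive ] lowered-or-top

      next-choice : g (2 + q) ≤ f (2 + q) ⊎ g (2 + q) ≡ 2 + q
      next-choice rewrite raise-next f (suc q) a = lowered-or-top

      grows : ∀ i → suc i < n → g (suc i) ≤ stat (segment g 0 (suc i)) + 1
      grows i 1+i<n with <-cmp i (suc q)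
      ... | tri< i<1+q _ _ with m≤n⇒m<n∨m≡n (≤-pred i<1+q)
      ...   | inj₁ i<q = subst₂ (λ x l → x ≤ stat l + 1) (sym (g-below (suc i) i<q))
                           (segment-cong 0 (suc i) λ j _ j≤i → sym (g-below j (≤-trans (≤-pred j≤i) (<⇒≤ i<q))))
                           (proj₂ growth i 1+i<n)
      ...   | inj₂ refl = begin
        g (suc q)                          ≡⟨ raise-at f (suc q) a ⟩
        suc q                              ≡⟨ +-comm 1 q ⟩
        q + 1                              ≡⟨ cong (_+ 1) (staircase-value g q λ j j≤q → g-staircase j (m≤n⇒m≤1+n j≤q)) ⟨
        stat (segment g 0 (suc q)) + 1     ∎
      grows i 1+i<n | tri≈ _ refl _ = begin
        g (2 + q)                          ≡⟨ raise-next f (suc q) a ⟩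
        a                                  ≤⟨ a≤2+q ⟩
        2 + q                              ≡⟨ +-comm 1 (suc q) ⟩
        suc q + 1                          ≡⟨ cong (_+ 1) (staircase-value g (suc q) g-staircase) ⟨
        stat (segment g 0 (2 + q)) + 1     ∎
      grows i 1+i<n | tri> _ _ 1+q<i with m≤n⇒∃[o]m+o≡n 1+q<i
      ... | o , refl = begin
        g (3 + q + o)                      ≡⟨ g-beyond (3 + q + o) (s≤s (s≤s (s≤s (m≤m+n q o)))) ⟩
        f (3 + q + o)                      ≤⟨ proj₂ growth (2 + q + o) 1+i<n ⟩
        stat (segment f 0 (3 + q + o)) + 1 ≤⟨ +-monoˡ-≤ 1 (raise-dominates f g q o stair g-staircase
                                                 deviation-below next-below next-choice
                                                 (λ j 2+q<j → sym (g-beyond j 2+q<j))) ⟩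
        stat (segment g 0 (3 + q + o)) + 1 ∎

  Neighbour : ((ℕ → ℕ) → Set) → Set
  Neighbour R = Σ (ℕ → ℕ) λ h → GrowthFun stat n h × (∀ j → 2 + q < j → h j ≡ f j) × R h

  module Same = Raised (f (2 + q)) (inj₁ ≤-refl)
  module Top  = Raised (2 + q) (inj₂ refl)
  module Down (a : ℕ) (f₂≡1+a : f (2 + q) ≡ suc a) = Raised a (inj₁ (subst (a ≤_) (sym f₂≡1+a) (n≤1+n a)))

  same-beyond : ∀ j → suc q < j → Same.g j ≡ f j
  same-beyond j 1+q<j with m≤n⇒m<n∨m≡n 1+q<j
  ... | inj₁ 2+q<j = Same.g-beyond j 2+q<j
  ... | inj₂ refl  = raise-next f (suc q) (f (2 + q))

  raised-above : f (suc q) < Same.g (suc q)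
  raised-above = subst (f (suc q) <_) (sym (raise-at f (suc q) _)) (s≤s deviation-below)

  top-above : f (2 + q) < Top.g (2 + q)
  top-above = subst (f (2 + q) <_) (sym (raise-next f (suc q) _)) (s≤s next-below)

  down-below : ∀ a f₂≡1+a → Down.g a f₂≡1+a (2 + q) < f (2 + q)
  down-below a f₂≡1+a = subst₂ _<_ (sym (raise-next f (suc q) a)) (sym f₂≡1+a) (n<1+n a)

  w₁ w₂ : ℕ
  w₁ = suffixWeightℕ n f (suc q)
  w₂ = suffixWeightℕ n f (2 + q)

  -- w₁ = f (q + 2) + 1 + w₂, so equal parities force f (q + 2) ≠ 0.
  next-positive : w₁ % 2 ≡ w₂ % 2 → Σ ℕ λ a → f (2 + q) ≡ suc a
  next-positive same-parity with f (2 + q) in f₂≡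
  ... | suc a = a , refl
  ... | zero  = ⊥-elim (%2-suc w₂ (trans (cong (_% 2) w₁≡) same-parity))
    where
    w₁≡ : suc w₂ ≡ w₁
    w₁≡ = sym (trans (suffixWeightℕ-step n f (suc q) 2+q<n) (cong (_+ suc w₂) f₂≡))

  successor : Neighbour (f ≺[ n ]_)
  successor with parity w₁ | parity w₂
  ... | inj₂ odd | _ =
    Same.g , Same.growth-raised , Same.g-beyond , precedes-at (suc q) 1+q<n same-beyond (inj₂ (odd , raised-above))
  ... | inj₁ _ | inj₂ odd =
    Top.g , Top.growth-raised , Top.g-beyond , precedes-at (2 + q) 2+q<n Top.g-beyond (inj₂ (odd , top-above))
  ... | inj₁ even₁ | inj₁ even₂ with next-positive (trans even₁ (sym even₂))
  ...   | a , f₂≡1+a =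
    Down.g a f₂≡1+a , Down.growth-raised a f₂≡1+a , Down.g-beyond a f₂≡1+a ,
    precedes-at (2 + q) 2+q<n (Down.g-beyond a f₂≡1+a) (inj₁ (even₂ , down-below a f₂≡1+a))

  predecessor : Neighbour (_≺[ n ] f)
  predecessor with parity w₁ | parity w₂
  ... | inj₁ even | _ =
    Same.g , Same.growth-raised , Same.g-beyond , preceded-at (suc q) 1+q<n same-beyond (inj₁ (even , raised-above))
  ... | inj₂ _ | inj₁ even =
    Top.g , Top.growth-raised , Top.g-beyond , preceded-at (2 + q) 2+q<n Top.g-beyond (inj₁ (even , top-above))
  ... | inj₂ odd₁ | inj₂ odd₂ with next-positive (trans odd₁ (sym odd₂))
  ...   | a , f₂≡1+a =
    Down.g a f₂≡1+a , Down.growth-raised a f₂≡1+a , Down.g-beyond a f₂≡1+a ,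
    preceded-at (2 + q) 2+q<n (Down.g-beyond a f₂≡1+a) (inj₂ (odd₂ , down-below a f₂≡1+a))

staircase-or-first-deviation : ∀ (x : ℕ → ℕ) N →
  (∀ i → i < N → x i ≡ i) ⊎ Σ ℕ λ p → p < N × x p ≢ p × (∀ i → i < p → x i ≡ i)
staircase-or-first-deviation x zero = inj₁ λ _ ()
staircase-or-first-deviation x (suc N) with staircase-or-first-deviation x N
... | inj₂ (p , p<N , deviates , below) = inj₂ (p , m<n⇒m<1+n p<N , deviates , below)
... | inj₁ below with x N ≟ N
...   | no  deviates = inj₂ (N , n<1+n N , deviates , below)
...   | yes xN≡N     = inj₁ λ i i<1+N → [ below i , (λ { refl → xN≡N }) ] (m≤n⇒m<n∨m≡n (≤-pred i<1+N))

first-deviation : ∀ (x : ℕ → ℕ) {j} → x 0 ≡ 0 → x j ≢ j →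
  Σ ℕ λ q → suc q ≤ j × Staircase x q × x (suc q) ≢ suc q
first-deviation x {j} x₀≡0 deviates with staircase-or-first-deviation x (suc j)
... | inj₁ below                      = ⊥-elim (deviates (below j ≤-refl))
... | inj₂ (zero  , _ , deviates₀ , _) = ⊥-elim (deviates₀ x₀≡0)
... | inj₂ (suc q , 1+q<1+j , deviates′ , below) =
  q , ≤-pred 1+q<1+j , (λ i i≤q → below i (s≤s i≤q)) , deviates′

module Consecutive {stat} (isStat : StaircaseStatistic stat) {n f g}
  (growth-f : GrowthFun stat n f) (growth-g : GrowthFun stat n g) (f≺g : f ≺[ n ] g)
  (nothing-between : ¬ Σ (ℕ → ℕ) λ h → GrowthFun stat n h × f ≺[ n ] h × h ≺[ n ] g) where

  k : ℕ
  k = proj₁ f≺g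

  k<n : k < n
  k<n = proj₁ (proj₂ f≺g)

  f≐g-after-k : ∀ j → k < j → j < n → f j ≡ g j
  f≐g-after-k = proj₁ (proj₂ (proj₂ f≺g))

  f-cannot-deviate : ∀ q → 2 + q < k → Staircase f q → f (suc q) ≢ suc q → ⊥
  f-cannot-deviate q 2+q<k stair deviates with FirstDeviation.successor isStat growth-f q (<-trans 2+q<k k<n) stair deviates
  ... | h , growth-h , h≐f , f≺h =
    nothing-between (h , growth-h , f≺h , ≺[]-congˡ f≺g λ i k≤i _ → h≐f i (<-≤-trans 2+q<k k≤i))

  g-cannot-deviate : ∀ q → 2 + q < k → Staircase g q → g (suc q) ≢ suc q → ⊥
  g-cannot-deviate q 2+q<k stair deviates with FirstDeviation.predecessor isStat growth-g q (<-trans 2+q<k k<n) stair deviates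
  ... | h , growth-h , h≐g , h≺g =
    nothing-between (h , growth-h , ≺[]-congʳ f≺g (λ i k≤i _ → h≐g i (<-≤-trans 2+q<k k≤i)) , h≺g)

  on-staircase : ∀ {x} → GrowthFun stat n x → (∀ q → 2 + q < k → Staircase x q → x (suc q) ≢ suc q → ⊥) →
    ∀ j → suc j < k → x j ≡ j
  on-staircase {x} growth-x cannot-deviate j 1+j<k with x j ≟ j
  ... | yes xj≡j = xj≡j
  ... | no  deviates with first-deviation x (proj₁ growth-x) deviates
  ...   | q , 1+q≤j , stair , deviates′ = ⊥-elim (cannot-deviate q (≤-<-trans (s≤s 1+q≤j) 1+j<k) stair deviates′)

  differences-near-k : ∀ j → j < n → f j ≢ g j → j ≡ k ∸ 1 ⊎ j ≡ suc (k ∸ 1)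
  differences-near-k j j<n fj≢gj with <-cmp k j
  ... | tri< k<j _ _ = ⊥-elim (fj≢gj (f≐g-after-k j k<j j<n))
  ... | tri≈ _ refl _ = k-itself k
    where
    k-itself : ∀ m → m ≡ m ∸ 1 ⊎ m ≡ suc (m ∸ 1)
    k-itself zero    = inj₁ refl
    k-itself (suc m) = inj₂ refl
  ... | tri> _ _ j<k with m≤n⇒m<n∨m≡n j<k
  ...   | inj₁ 1+j<k = ⊥-elim (fj≢gj (trans (on-staircase growth-f f-cannot-deviate j 1+j<k)
                                           (sym (on-staircase growth-g g-cannot-deviate j 1+j<k))))
  ...   | inj₂ refl  = inj₁ refl

hammingL-segment-≡0 : ∀ {f g} a d → (∀ j → a ≤ j → j < a + d → f j ≡ g j) →
  hammingL (segment f a d) (segment g a d) ≡ 0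
hammingL-segment-≡0 a zero    _   = refl
hammingL-segment-≡0 {f} {g} a (suc d) f≐g rewrite dec-true (f a ≟ g a) (f≐g a ≤-refl (m<m+n a z<s)) =
  hammingL-segment-≡0 (suc a) d (range-tail a d f≐g)

hammingL-segment-≤1 : ∀ {f g} p a d → (∀ j → a ≤ j → j < a + d → f j ≢ g j → j ≡ p) →
  hammingL (segment f a d) (segment g a d) ≤ 1
hammingL-segment-≤1 p a zero    _      = z≤n
hammingL-segment-≤1 {f} {g} p a (suc d) only-p with f a ≟ g a
... | yes fa≡ga rewrite dec-true (f a ≟ g a) fa≡ga = hammingL-segment-≤1 p (suc a) d (range-tail a d only-p)
... | no  fa≢ga rewrite dec-false (f a ≟ g a) fa≢ga = ≤-reflexive (cong suc (hammingL-segment-≡0 (suc a) d agree))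
  where
  agree : ∀ j → suc a ≤ j → j < suc a + d → f j ≡ g j
  agree j a<j j< with f j ≟ g j
  ... | yes fj≡gj = fj≡gj
  ... | no  fj≢gj = ⊥-elim (<⇒≢ a<j (trans (only-p a ≤-refl (m<m+n a z<s) fa≢ga)
                                           (sym (range-tail a d only-p j a<j j< fj≢gj))))

hammingL-segment-≤2 : ∀ {f g} p a d → (∀ j → a ≤ j → j < a + d → f j ≢ g j → j ≡ p ⊎ j ≡ suc p) →
  hammingL (segment f a d) (segment g a d) ≤ 2
hammingL-segment-≤2 p a zero    _      = z≤n
hammingL-segment-≤2 {f} {g} p a (suc d) near-p with f a ≟ g a
... | yes fa≡ga rewrite dec-true (f a ≟ g a) fa≡ga = hammingL-segment-≤2 p (suc a) d (range-tail a d near-p)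
... | no  fa≢ga rewrite dec-false (f a ≟ g a) fa≢ga =
  s≤s (hammingL-segment-≤1 (suc p) (suc a) d λ j a<j j< fj≢gj →
    later (near-p a ≤-refl (m<m+n a z<s) fa≢ga) a<j (range-tail a d near-p j a<j j< fj≢gj))
  where
  later : ∀ {j} → a ≡ p ⊎ a ≡ suc p → a < j → j ≡ p ⊎ j ≡ suc p → j ≡ suc p
  later _           _   (inj₂ j≡1+p) = j≡1+p
  later (inj₁ refl) a<j (inj₁ refl)  = ⊥-elim (<-irrefl refl a<j)
  later (inj₂ refl) a<j (inj₁ refl)  = ⊥-elim (<-irrefl refl (<-trans (n<1+n _) a<j))

confined⇒2-adjacent : ∀ {n} (s t : Vec ℕ n) p →
  (∀ j → j < n → entry s j ≢ entry t j → j ≡ p ⊎ j ≡ suc p) → DAdjacent 2 s t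
confined⇒2-adjacent {n} s t p confined = hamming≤2 , adjacent
  where
  hamming≤2 : hamming s t ≤ 2
  hamming≤2 = subst₂ (λ l l′ → hammingL l l′ ≤ 2) (sym (toList≡segment s)) (sym (toList≡segment t))
    (hammingL-segment-≤2 p 0 n λ j _ j<n → confined j j<n)

  differs : (i : Fin n) → lookup s i ≢ lookup t i → toℕ i ≡ p ⊎ toℕ i ≡ suc p
  differs i sᵢ≢tᵢ = confined (toℕ i) (toℕ<n i) λ e →
    sᵢ≢tᵢ (trans (lookup≡entry s i) (trans e (sym (lookup≡entry t i))))

  p≤ : ∀ {x} → x ≡ p ⊎ x ≡ suc p → p ≤ x
  p≤ (inj₁ refl) = ≤-refl
  p≤ (inj₂ refl) = n≤1+n p

  ≤1+p : ∀ {x} → x ≡ p ⊎ x ≡ suc p → x ≤ suc p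
  ≤1+p (inj₁ refl) = n≤1+n p
  ≤1+p (inj₂ refl) = ≤-refl

  adjacent : DiffAdjacent s t
  adjacent i j l i<j j<l sᵢ≢tᵢ sₗ≢tₗ _ = <-irrefl refl (begin-strict
    suc p             ≤⟨ s≤s (p≤ (differs i sᵢ≢tᵢ)) ⟩
    suc (toℕ i)       <⟨ s≤s i<j ⟩
    suc (toℕ j)       ≤⟨ j<l ⟩
    toℕ l             ≤⟨ ≤1+p (differs l sₗ≢tₗ) ⟩
    suc p             ∎)
    where open ≤-Reasoning

growth-gray-code : ∀ {stat} → StaircaseStatistic stat → ∀ m → IsDAdjacentGrayCode 2 {suc m} (Growth stat)
growth-gray-code {stat} isStat m s t s∈ t∈ s≺t nothing-between =
  confined⇒2-adjacent s t (k ∸ 1) differences-near-k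
  where
  nothing-between′ : ¬ Σ (ℕ → ℕ) λ h → GrowthFun stat (suc m) h × entry s ≺[ suc m ] h × h ≺[ suc m ] entry t
  nothing-between′ (h , growth-h , s≺h , h≺t) = nothing-between
    (u , growthFun⇒growth stat u (growthFun-cong {stat} growth-h entry≡h) ,
     ≺[]⇒≺c s u (≺[]-congʳ s≺h λ j _ → entry≡h j) , ≺[]⇒≺c u t (≺[]-congˡ h≺t λ j _ → entry≡h j))
    where
    u : Vec ℕ (suc m)
    u = fromFunction (suc m) h

    entry≡h : ∀ j → j < suc m → entry (fromFunction (suc m) h) j ≡ h j
    entry≡h j = entry-fromFunction (suc m) h

  open Consecutive isStat (growth⇒growthFun stat s s∈) (growth⇒growthFun stat t t∈) (≺c⇒≺[] s t s≺t)
    nothing-between′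

theorem3 : (m : ℕ) →
    IsDAdjacentGrayCode 2 {suc m} InA × IsDAdjacentGrayCode 2 {suc m} InR
theorem3 m = growth-gray-code ascStatistic m , growth-gray-code maxStatistic m
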